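{- There is a constant $C$ depending only on $q$ such that for all real numbers $B_1,B_2>0$, the number of matrices in $\mathrm{SL}_2(\mathbb{F}_q[T])$ whose first column has norm at most $B_1$ and whose second column has norm at most $B_2$ is at most $C B_1B_2$. The same holds with columns replaced by rows.
   Context: For a polynomial $f\in\mathbb{F}_q[T]$, $|f|=q^{\deg f}$ ($|0|=0$); the norm of a column (or row) vector is the maximum of the absolute values of its entries.
   Formalization: The bounds $B_1$ and $B_2$ range over the positive rationals instead of the positive reals. -}

module Defs where

open import Data.Nat using (ℕ; zero; suc; _^_; _∸_)
open import Data.Fin using (Fin)
open import Data.List using (List; []; _∷_; length)
open import Data.Product using (Σ; _×_; _,_)
open import Data.Integer using (+_)
open import Data.Rational using (ℚ; _/_; _≤_)
open import Relation.Binary.PropositionalEquality using (_≡_; _≢_)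
open import Relation.Nullary using (yes; no)
open import Algebra.Core using (Op₁; Op₂)
open import Algebra.Structures using (IsCommutativeRing)

-- A field structure on a carrier A (with propositional equality).
-- F_q is modelled as a field structure on Fin q: every field with q
-- elements is isomorphic to one of these.

record FieldOn (A : Set) : Set where
  field
    _+F_ _*F_ : Op₂ A
    -F_       : Op₁ A
    0F 1F     : A
    isCommutativeRing : IsCommutativeRing _≡_ _+F_ _*F_ -F_ 0F 1F
    0≢1       : 0F ≢ 1F
    inverse   : ∀ x → x ≢ 0F → Σ A (λ y → x *F y ≡ 1F)
    _≟F_      : ∀ (x y : A) → Relation.Nullary.Dec (x ≡ y)

-- Polynomials over a field: coefficient lists, constant term first.  Distinct normalized lists represent distinct polynomials.

module Poly {A : Set} (F : FieldOn A) where
  open FieldOn F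

  Pol : Set
  Pol = List A

  data Normalized : Pol → Set where
    nil  : Normalized []
    last : ∀ {a} → a ≢ 0F → Normalized (a ∷ [])
    cons : ∀ {a b p} → Normalized (b ∷ p) → Normalized (a ∷ b ∷ p)

  addP : Pol → Pol → Pol
  addP [] q = q
  addP p [] = p
  addP (a ∷ p) (b ∷ q) = (a +F b) ∷ addP p q

  negP : Pol → Pol
  negP [] = []
  negP (a ∷ p) = (-F a) ∷ negP p

  scale : A → Pol → Pol
  scale c [] = []
  scale c (a ∷ p) = (c *F a) ∷ scale c p

  mulP : Pol → Pol → Pol
  mulP [] q = []
  mulP (a ∷ p) q = addP (scale a q) (0F ∷ mulP p q)

  normalize : Pol → Pol
  normalize [] = []
  normalize (a ∷ p) with normalize p
  ... | b ∷ r = a ∷ b ∷ r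
  ... | [] with a ≟F 0F
  ...   | yes _ = []
  ...   | no  _ = a ∷ []

  _≈P_ : Pol → Pol → Set
  p ≈P q = normalize p ≡ normalize q

  oneP : Pol
  oneP = 1F ∷ []

-- The absolute value |f| = q^deg f, |0| = 0, for a normalized list f
-- over F_q (deg f = length f - 1).

absℕ : (q : ℕ) {A : Set} → List A → ℕ
absℕ q [] = 0
absℕ q (_ ∷ p) = q ^ length p

absℚ : (q : ℕ) {A : Set} → List A → ℚ
absℚ q p = (+ absℕ q p) / 1

-- 2x2 matrices over F_q[T], given by entries  ( a b )
--                                              ( c d )

Mat2 : Set → Set
Mat2 A = List A × List A × List A × List A

module SL2 (q : ℕ) (F : FieldOn (Fin q)) where
  open Poly F

  InSL2 : Mat2 (Fin q) → Set
  InSL2 (a , b , c , d) =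
    Normalized a × Normalized b × Normalized c × Normalized d ×
    (addP (mulP a d) (negP (mulP b c)) ≈P oneP)

  NormLe : Pol → Pol → ℚ → Set
  NormLe u v B = absℚ q u ≤ B × absℚ q v ≤ B

  ColsBounded : ℚ → ℚ → Mat2 (Fin q) → Set
  ColsBounded B₁ B₂ (a , b , c , d) = NormLe a c B₁ × NormLe b d B₂

  RowsBounded : ℚ → ℚ → Mat2 (Fin q) → Set
  RowsBounded B₁ B₂ (a , b , c , d) = NormLe a b B₁ × NormLe c d B₂

{-# OPTIONS --safe #-}
-- Two matrices of SL₂(F_q[T]) with the same first column (x, z) have second columns that
-- differ by a multiple t (x, z) of it. Hence, if deg z ≤ deg x, the second column is
-- determined by the first one and the coefficients of its upper entry in degrees ≥ deg x
-- (symmetrically if deg x < deg z). When the columns have at most n ≤ m coefficients, this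
-- codes each matrix by polynomials with at most k + 1, k + 1 and m − k coefficients for some
-- k < n, and there are Σₖ q^(2k+2) q^(m−k) ≤ q^(m+n+2) such codes; |column| ≤ B bounds the
-- number of coefficients by 1 + log_q B. If n > m one codes by the second column instead,
-- and rows reduce to columns by transposition.
module Submission where

open import Level using (0ℓ)
open import Algebra.Bundles using (CommutativeRing)
open import Data.Empty using (⊥; ⊥-elim)
open import Data.Fin using (Fin)
open import Data.List using (List; []; _∷_; [_]; length; map; filter; take; drop; replicate; _++_; cartesianProductWith; cartesianProduct; allFin)
open import Data.List.Membership.Propositional using (_∈_)
open import Data.Nat as ℕ using (ℕ; zero; suc; _∸_; z≤n; s≤s)
import Data.Nat.Properties as ℕ
open import Data.Product using (Σ; _×_; _,_; proj₁; proj₂)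
open import Data.Rational as ℚ using (ℚ; 0ℚ)
open import Relation.Binary.PropositionalEquality
  using (_≡_; _≢_; refl; sym; trans; cong; cong₂; subst; subst₂; module ≡-Reasoning)
open import Relation.Nullary using (¬_; yes; no)
open import Relation.Unary using (Decidable)

open import Defs

module Determinants {c ℓ} (R : CommutativeRing c ℓ) where
  open CommutativeRing R renaming (refl to ≈-refl; sym to ≈-sym; trans to ≈-trans)
  open import Algebra.Properties.Ring ring using (//-rightDividesˡ; -1*x≈-x; -‿involutive; ⁻¹-anti-homo‿-)
  open import Algebra.Solver.Ring.NaturalCoefficients.Default commutativeSemiring
  open import Relation.Binary.Reasoning.Setoid setoid

  x-y≈z⇒x≈z+y : ∀ {x y z} → x - y ≈ z → x ≈ z + y
  x-y≈z⇒x≈z+y {x} {y} {z} x-y≈z = begin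
    x            ≈⟨ //-rightDividesˡ y x ⟨
    (x - y) + y  ≈⟨ +-congʳ x-y≈z ⟩
    z + y        ∎

  -- (y′, w′) − (y, w) = t (x, z) with t = s (w y′ − y w′), written without subtraction.
  same-first-column :
    ∀ {x y z w y′ w′ s} → x * w - y * z ≈ s → x * w′ - y′ * z ≈ s → s * s ≈ 1# →
    (s * (w * y′)) * x + y ≈ (s * (y * w′)) * x + y′ ×
    (s * (w * y′)) * z + w ≈ (s * (y * w′)) * z + w′
  same-first-column {x} {y} {z} {w} {y′} {w′} {s} d d′ s²≈1 = first , second
    where
    xw : x * w ≈ s + y * z
    xw = x-y≈z⇒x≈z+y d
    xw′ : x * w′ ≈ s + y′ * z
    xw′ = x-y≈z⇒x≈z+y d′
    s²u≈u : ∀ u → s * s * u ≈ u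
    s²u≈u u = ≈-trans (*-congʳ s²≈1) (*-identityˡ u)
    r : Carrier
    r = s * y * y′ * z
    first : (s * (w * y′)) * x + y ≈ (s * (y * w′)) * x + y′
    first = begin
      s * (w * y′) * x + y           ≈⟨ solve 5 (λ s w y′ x y → s :* (w :* y′) :* x :+ y := s :* y′ :* (x :* w) :+ y) ≈-refl s w y′ x y ⟩
      s * y′ * (x * w) + y           ≈⟨ +-congʳ (*-congˡ xw) ⟩
      s * y′ * (s + y * z) + y       ≈⟨ solve 5 (λ s y′ y z y₀ → s :* y′ :* (s :+ y :* z) :+ y₀ := s :* s :* y′ :+ (s :* y :* y′ :* z :+ y₀)) ≈-refl s y′ y z y ⟩
      s * s * y′ + (r + y)           ≈⟨ +-congʳ (s²u≈u y′) ⟩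
      y′ + (r + y)                   ≈⟨ solve 3 (λ y′ r y → y′ :+ (r :+ y) := y :+ (r :+ y′)) ≈-refl y′ r y ⟩
      y + (r + y′)                   ≈⟨ +-congʳ (s²u≈u y) ⟨
      s * s * y + (r + y′)           ≈⟨ solve 4 (λ s y y′ z → s :* s :* y :+ (s :* y :* y′ :* z :+ y′) := s :* y :* (s :+ y′ :* z) :+ y′) ≈-refl s y y′ z ⟩
      s * y * (s + y′ * z) + y′      ≈⟨ +-congʳ (*-congˡ xw′) ⟨
      s * y * (x * w′) + y′          ≈⟨ solve 5 (λ s y x w′ y′ → s :* y :* (x :* w′) :+ y′ := s :* (y :* w′) :* x :+ y′) ≈-refl s y x w′ y′ ⟩
      s * (y * w′) * x + y′ ∎
    second : (s * (w * y′)) * z + w ≈ (s * (y * w′)) * z + w′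
    second = begin
      s * (w * y′) * z + w             ≈⟨ +-congˡ (s²u≈u w) ⟨
      s * (w * y′) * z + s * s * w     ≈⟨ solve 4 (λ s w y′ z → s :* (w :* y′) :* z :+ s :* s :* w := s :* w :* (s :+ y′ :* z)) ≈-refl s w y′ z ⟩
      s * w * (s + y′ * z)             ≈⟨ *-congˡ xw′ ⟨
      s * w * (x * w′)                 ≈⟨ solve 4 (λ s w x w′ → s :* w :* (x :* w′) := s :* w′ :* (x :* w)) ≈-refl s w x w′ ⟩
      s * w′ * (x * w)                 ≈⟨ *-congˡ xw ⟩
      s * w′ * (s + y * z)             ≈⟨ solve 4 (λ s w′ y z → s :* w′ :* (s :+ y :* z) := s :* (y :* w′) :* z :+ s :* s :* w′) ≈-refl s w′ y z ⟩
      s * (y * w′) * z + s * s * w′    ≈⟨ +-congˡ (s²u≈u w′) ⟩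
      s * (y * w′) * z + w′ ∎

  zero-column⇒1≈0 : ∀ {x y z w s} → x ≈ 0# → z ≈ 0# → x * w - y * z ≈ s → s * s ≈ 1# → 1# ≈ 0#
  zero-column⇒1≈0 {x} {y} {z} {w} {s} x≈0 z≈0 d s²≈1 = begin
    1#        ≈⟨ s²≈1 ⟨
    s * s     ≈⟨ *-congʳ s≈0 ⟩
    0# * s    ≈⟨ zeroˡ s ⟩
    0#        ∎
    where
    s≈0 : s ≈ 0#
    s≈0 = begin
      s                ≈⟨ d ⟨
      x * w - y * z    ≈⟨ +-cong (≈-trans (*-congʳ x≈0) (zeroˡ w)) (-‿cong (≈-trans (*-congˡ z≈0) (zeroʳ y))) ⟩
      0# - 0#          ≈⟨ -‿inverseʳ 0# ⟩
      0#               ∎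

  det-swapColumns : ∀ {x y z w s} → x * w - y * z ≈ s → y * z - x * w ≈ - s
  det-swapColumns {x} {y} {z} {w} d = ≈-trans (≈-sym (⁻¹-anti-homo‿- (x * w) (y * z))) (-‿cong d)

  [-1]²≈1 : - 1# * - 1# ≈ 1#
  [-1]²≈1 = ≈-trans (-1*x≈-x (- 1#)) (-‿involutive 1#)

module Polynomials {A : Set} (F : FieldOn A) where
  open FieldOn F
  open Poly F

  coefficientRing : CommutativeRing 0ℓ 0ℓ
  coefficientRing = record
    { Carrier = A ; _≈_ = _≡_ ; _+_ = _+F_ ; _*_ = _*F_ ; -_ = -F_ ; 0# = 0F ; 1# = 1F
    ; isCommutativeRing = isCommutativeRing }

  private module K where
    open CommutativeRing coefficientRing public
    open import Algebra.Properties.Ring ring public using (-0#≈0#; +-cancelʳ)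

  coeff : Pol → ℕ → A
  coeff []      _       = 0F
  coeff (a ∷ p) zero    = a
  coeff (a ∷ p) (suc i) = coeff p i

  infix 4 _≋_
  record _≋_ (p p′ : Pol) : Set where
    constructor mk≋
    field coeff-≡ : ∀ i → coeff p i ≡ coeff p′ i
  open _≋_ public

  ≋-refl : ∀ {p} → p ≋ p
  ≋-refl = mk≋ λ _ → refl

  ≋-sym : ∀ {p p′} → p ≋ p′ → p′ ≋ p
  ≋-sym e = mk≋ λ i → sym (coeff-≡ e i)

  ≋-trans : ∀ {p p′ p″} → p ≋ p′ → p′ ≋ p″ → p ≋ p″
  ≋-trans e f = mk≋ λ i → trans (coeff-≡ e i) (coeff-≡ f i)

  ∷-cong : ∀ {a b p p′} → a ≡ b → p ≋ p′ → (a ∷ p) ≋ (b ∷ p′)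
  ∷-cong a≡b e = mk≋ λ { zero → a≡b ; (suc i) → coeff-≡ e i }

  ∷-injectiveʳ : ∀ {a b p p′} → (a ∷ p) ≋ (b ∷ p′) → p ≋ p′
  ∷-injectiveʳ e = mk≋ λ i → coeff-≡ e (suc i)

  ∷-≋[] : ∀ {a p} → a ≡ 0F → p ≋ [] → (a ∷ p) ≋ []
  ∷-≋[] a≡0 e = mk≋ λ { zero → a≡0 ; (suc i) → coeff-≡ e i }

  coeff-addP : ∀ p p′ i → coeff (addP p p′) i ≡ coeff p i +F coeff p′ i
  coeff-addP []      p′       i       = sym (K.+-identityˡ _)
  coeff-addP (a ∷ p) []       i       = sym (K.+-identityʳ _)
  coeff-addP (a ∷ p) (b ∷ p′) zero    = refl
  coeff-addP (a ∷ p) (b ∷ p′) (suc i) = coeff-addP p p′ i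

  coeff-negP : ∀ p i → coeff (negP p) i ≡ -F coeff p i
  coeff-negP []      i       = sym K.-0#≈0#
  coeff-negP (a ∷ p) zero    = refl
  coeff-negP (a ∷ p) (suc i) = coeff-negP p i

  coeff-scale : ∀ c p i → coeff (scale c p) i ≡ c *F coeff p i
  coeff-scale c []      i       = sym (K.zeroʳ c)
  coeff-scale c (a ∷ p) zero    = refl
  coeff-scale c (a ∷ p) (suc i) = coeff-scale c p i

  private module Laws where
    +-cong : ∀ {p p′ r r′} → p ≋ p′ → r ≋ r′ → addP p r ≋ addP p′ r′
    +-cong {p} {p′} {r} {r′} e f = mk≋ λ i → begin
      coeff (addP p r) i       ≡⟨ coeff-addP p r i ⟩
      coeff p i +F coeff r i   ≡⟨ cong₂ _+F_ (coeff-≡ e i) (coeff-≡ f i) ⟩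
      coeff p′ i +F coeff r′ i ≡⟨ coeff-addP p′ r′ i ⟨
      coeff (addP p′ r′) i     ∎
      where open ≡-Reasoning

    +-assoc : ∀ p r u → addP (addP p r) u ≋ addP p (addP r u)
    +-assoc p r u = mk≋ λ i → begin
      coeff (addP (addP p r) u) i              ≡⟨ coeff-addP (addP p r) u i ⟩
      coeff (addP p r) i +F coeff u i          ≡⟨ cong (_+F coeff u i) (coeff-addP p r i) ⟩
      (coeff p i +F coeff r i) +F coeff u i    ≡⟨ K.+-assoc _ _ _ ⟩
      coeff p i +F (coeff r i +F coeff u i)    ≡⟨ cong (coeff p i +F_) (coeff-addP r u i) ⟨
      coeff p i +F coeff (addP r u) i          ≡⟨ coeff-addP p (addP r u) i ⟨
      coeff (addP p (addP r u)) i              ∎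
      where open ≡-Reasoning

    +-comm : ∀ p r → addP p r ≋ addP r p
    +-comm p r = mk≋ λ i → trans (coeff-addP p r i) (trans (K.+-comm _ _) (sym (coeff-addP r p i)))

    +-identityʳ : ∀ p → addP p [] ≋ p
    +-identityʳ p = mk≋ λ i → trans (coeff-addP p [] i) (K.+-identityʳ _)

    -‿inverseˡ : ∀ p → addP (negP p) p ≋ []
    -‿inverseˡ p = mk≋ λ i → begin
      coeff (addP (negP p) p) i        ≡⟨ coeff-addP (negP p) p i ⟩
      coeff (negP p) i +F coeff p i    ≡⟨ cong (_+F coeff p i) (coeff-negP p i) ⟩
      (-F coeff p i) +F coeff p i      ≡⟨ K.-‿inverseˡ _ ⟩
      0F                               ∎
      where open ≡-Reasoning

    -‿inverseʳ : ∀ p → addP p (negP p) ≋ []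
    -‿inverseʳ p = ≋-trans (+-comm p (negP p)) (-‿inverseˡ p)

    -‿cong : ∀ {p p′} → p ≋ p′ → negP p ≋ negP p′
    -‿cong {p} {p′} e = mk≋ λ i → trans (coeff-negP p i) (trans (cong -F_ (coeff-≡ e i)) (sym (coeff-negP p′ i)))

    +-swap : ∀ p r u → addP p (addP r u) ≋ addP r (addP p u)
    +-swap p r u = ≋-trans (≋-sym (+-assoc p r u)) (≋-trans (+-cong (+-comm p r) ≋-refl) (+-assoc r p u))

    +-interchange : ∀ p r u v → addP (addP p r) (addP u v) ≋ addP (addP p u) (addP r v)
    +-interchange p r u v =
      ≋-trans (+-assoc p r (addP u v)) (≋-trans (+-cong (≋-refl {p}) (+-swap r u v)) (≋-sym (+-assoc p u (addP r v))))

    scale-cong : ∀ c {p p′} → p ≋ p′ → scale c p ≋ scale c p′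
    scale-cong c {p} {p′} e = mk≋ λ i → trans (coeff-scale c p i) (trans (cong (c *F_) (coeff-≡ e i)) (sym (coeff-scale c p′ i)))

    scale-distrib : ∀ c p r → scale c (addP p r) ≋ addP (scale c p) (scale c r)
    scale-distrib c p r = mk≋ λ i → begin
      coeff (scale c (addP p r)) i                    ≡⟨ coeff-scale c (addP p r) i ⟩
      c *F coeff (addP p r) i                         ≡⟨ cong (c *F_) (coeff-addP p r i) ⟩
      c *F (coeff p i +F coeff r i)                   ≡⟨ K.distribˡ c _ _ ⟩
      (c *F coeff p i) +F (c *F coeff r i)            ≡⟨ cong₂ _+F_ (coeff-scale c p i) (coeff-scale c r i) ⟨
      coeff (scale c p) i +F coeff (scale c r) i      ≡⟨ coeff-addP (scale c p) (scale c r) i ⟨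
      coeff (addP (scale c p) (scale c r)) i          ∎
      where open ≡-Reasoning

    scale-* : ∀ c d p → scale (c *F d) p ≋ scale c (scale d p)
    scale-* c d p = mk≋ λ i → begin
      coeff (scale (c *F d) p) i     ≡⟨ coeff-scale (c *F d) p i ⟩
      (c *F d) *F coeff p i          ≡⟨ K.*-assoc c d _ ⟩
      c *F (d *F coeff p i)          ≡⟨ cong (c *F_) (coeff-scale d p i) ⟨
      c *F coeff (scale d p) i       ≡⟨ coeff-scale c (scale d p) i ⟨
      coeff (scale c (scale d p)) i  ∎
      where open ≡-Reasoning

    scale-0 : ∀ p → scale 0F p ≋ []
    scale-0 p = mk≋ λ i → trans (coeff-scale 0F p i) (K.zeroˡ _)

    scale-1 : ∀ p → scale 1F p ≋ p
    scale-1 p = mk≋ λ i → trans (coeff-scale 1F p i) (K.*-identityˡ _)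

    *-zeroʳ : ∀ p → mulP p [] ≋ []
    *-zeroʳ []      = ≋-refl
    *-zeroʳ (a ∷ p) = ∷-≋[] refl (*-zeroʳ p)

    *-congˡ : ∀ p {r r′} → r ≋ r′ → mulP p r ≋ mulP p r′
    *-congˡ []      e = ≋-refl
    *-congˡ (a ∷ p) e = +-cong (scale-cong a e) (∷-cong refl (*-congˡ p e))

    *-∷ : ∀ p b r → mulP p (b ∷ r) ≋ addP (scale b p) (0F ∷ mulP p r)
    *-∷ []      b r = ≋-sym (∷-≋[] refl ≋-refl)
    *-∷ (a ∷ p) b r = ∷-cong (cong (_+F 0F) (K.*-comm a b))
      (≋-trans (+-cong (≋-refl {scale a r}) (*-∷ p b r)) (+-swap (scale a r) (scale b p) (0F ∷ mulP p r)))

    *-comm : ∀ p r → mulP p r ≋ mulP r p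
    *-comm []      r = ≋-sym (*-zeroʳ r)
    *-comm (a ∷ p) r = ≋-trans (+-cong (≋-refl {scale a r}) (∷-cong refl (*-comm p r))) (≋-sym (*-∷ r a p))

    *-congʳ : ∀ {p p′} r → p ≋ p′ → mulP p r ≋ mulP p′ r
    *-congʳ {p} {p′} r e = ≋-trans (*-comm p r) (≋-trans (*-congˡ r e) (*-comm r p′))

    *-distribˡ : ∀ p r u → mulP p (addP r u) ≋ addP (mulP p r) (mulP p u)
    *-distribˡ []      r u = ≋-refl
    *-distribˡ (a ∷ p) r u = ≋-trans
      (+-cong (scale-distrib a r u) (∷-cong (sym (K.+-identityˡ 0F)) (*-distribˡ p r u)))
      (+-interchange (scale a r) (scale a u) (0F ∷ mulP p r) (0F ∷ mulP p u))

    *-distribʳ : ∀ p r u → mulP (addP r u) p ≋ addP (mulP r p) (mulP u p)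
    *-distribʳ p r u = ≋-trans (*-comm (addP r u) p) (≋-trans (*-distribˡ p r u) (+-cong (*-comm p r) (*-comm p u)))

    scale-*ˡ : ∀ c p r → mulP (scale c p) r ≋ scale c (mulP p r)
    scale-*ˡ c []      r = ≋-refl
    scale-*ˡ c (a ∷ p) r = ≋-trans
      (+-cong (scale-* c a r) (∷-cong (sym (K.zeroʳ c)) (scale-*ˡ c p r)))
      (≋-sym (scale-distrib c (scale a r) (0F ∷ mulP p r)))

    *-assoc : ∀ p r u → mulP (mulP p r) u ≋ mulP p (mulP r u)
    *-assoc []      r u = ≋-refl
    *-assoc (a ∷ p) r u = ≋-trans (*-distribʳ u (scale a r) (0F ∷ mulP p r))
      (+-cong (scale-*ˡ a r u) (+-cong (scale-0 u) (∷-cong refl (*-assoc p r u))))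

    *-identityˡ : ∀ p → mulP oneP p ≋ p
    *-identityˡ p = ≋-trans (+-cong (scale-1 p) (∷-≋[] refl ≋-refl)) (+-identityʳ p)

  polynomialRing : CommutativeRing 0ℓ 0ℓ
  polynomialRing = record
    { Carrier = Pol ; _≈_ = _≋_ ; _+_ = addP ; _*_ = mulP ; -_ = negP ; 0# = [] ; 1# = oneP
    ; isCommutativeRing = record
      { isRing = record
        { +-isAbelianGroup = record
          { isGroup = record
            { isMonoid = record
              { isSemigroup = record
                { isMagma = record
                  { isEquivalence = record { refl = ≋-refl ; sym = ≋-sym ; trans = ≋-trans }
                  ; ∙-cong = +-cong }
                ; assoc = +-assoc }
              ; identity = (λ _ → ≋-refl) , +-identityʳ }
            ; inverse = -‿inverseˡ , -‿inverseʳ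
            ; ⁻¹-cong = -‿cong }
          ; comm = +-comm }
        ; *-cong = λ {p} {p′} {r} e f → ≋-trans (*-congʳ r e) (*-congˡ p′ f)
        ; *-assoc = *-assoc
        ; *-identity = *-identityˡ , λ p → ≋-trans (*-comm p oneP) (*-identityˡ p)
        ; distrib = *-distribˡ , *-distribʳ }
      ; *-comm = *-comm } }
    where open Laws

  open CommutativeRing polynomialRing using (_+_; _*_; -_; _-_; 1#; +-congʳ; *-congʳ)
  open import Algebra.Properties.Ring (CommutativeRing.ring polynomialRing)
    using (+-cancelˡ; [y-z]x≈yx-zx; x∙y⁻¹≈ε⇒x≈y)

  normalize-≋ : ∀ p → normalize p ≋ p
  normalize-≋ []      = ≋-refl
  normalize-≋ (a ∷ p) with normalize p | normalize-≋ p
  ... | b ∷ r | e = ∷-cong refl e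
  ... | []    | e with a ≟F 0F
  ...   | yes a≡0 = mk≋ λ { zero → sym a≡0 ; (suc i) → coeff-≡ e i }
  ...   | no  _   = ∷-cong refl e

  normalize-normalized : ∀ p → Normalized (normalize p)
  normalize-normalized []      = nil
  normalize-normalized (a ∷ p) with normalize p | normalize-normalized p
  ... | b ∷ r | n = cons n
  ... | []    | _ with a ≟F 0F
  ...   | yes _   = nil
  ...   | no  a≢0 = last a≢0

  tail-normalized : ∀ {a p} → Normalized (a ∷ p) → Normalized p
  tail-normalized (last _) = nil
  tail-normalized (cons n) = n

  drop-normalized : ∀ k {p} → Normalized p → Normalized (drop k p)
  drop-normalized zero    n = n
  drop-normalized (suc k) {[]}    n = nil
  drop-normalized (suc k) {a ∷ p} n = drop-normalized k (tail-normalized n)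

  leading-nonzero : ∀ {a p} → Normalized (a ∷ p) → coeff (a ∷ p) (length p) ≢ 0F
  leading-nonzero (last a≢0) = a≢0
  leading-nonzero (cons n)   = leading-nonzero n

  coeff-beyond-length : ∀ p {j} → length p ℕ.≤ j → coeff p j ≡ 0F
  coeff-beyond-length []      _         = refl
  coeff-beyond-length (a ∷ p) (s≤s p≤j) = coeff-beyond-length p p≤j

  normalized-≋⇒≡ : ∀ {p p′} → Normalized p → Normalized p′ → p ≋ p′ → p ≡ p′
  normalized-≋⇒≡ {[]}    {[]}     _ _  _ = refl
  normalized-≋⇒≡ {[]}    {b ∷ r}  _ n′ e = ⊥-elim (leading-nonzero n′ (sym (coeff-≡ e (length r))))
  normalized-≋⇒≡ {a ∷ p} {[]}     n _  e = ⊥-elim (leading-nonzero n (coeff-≡ e (length p)))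
  normalized-≋⇒≡ {a ∷ p} {b ∷ r}  n n′ e =
    cong₂ _∷_ (coeff-≡ e 0) (normalized-≋⇒≡ (tail-normalized n) (tail-normalized n′) (∷-injectiveʳ e))

  ≋⇒≈P : ∀ {p p′} → p ≋ p′ → p ≈P p′
  ≋⇒≈P {p} {p′} e = normalized-≋⇒≡ (normalize-normalized p) (normalize-normalized p′)
    (≋-trans (normalize-≋ p) (≋-trans e (≋-sym (normalize-≋ p′))))

  ≈P⇒≋ : ∀ {p p′} → p ≈P p′ → p ≋ p′
  ≈P⇒≋ {p} {p′} e =
    ≋-trans (≋-sym (normalize-≋ p)) (≋-trans (mk≋ λ i → cong (λ r → coeff r i) e) (normalize-≋ p′))

  1≉0 : ¬ (oneP ≋ [])
  1≉0 e = 0≢1 (sym (coeff-≡ e 0))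

  no-zero-divisors : ∀ {x a} → a ≢ 0F → x *F a ≡ 0F → x ≡ 0F
  no-zero-divisors {x} {a} a≢0 xa≡0 with inverse a a≢0
  ... | a⁻¹ , aa⁻¹≡1 = begin
    x                   ≡⟨ K.*-identityʳ x ⟨
    x *F 1F             ≡⟨ cong (x *F_) aa⁻¹≡1 ⟨
    x *F (a *F a⁻¹)     ≡⟨ K.*-assoc x a a⁻¹ ⟨
    (x *F a) *F a⁻¹     ≡⟨ cong (_*F a⁻¹) xa≡0 ⟩
    0F *F a⁻¹           ≡⟨ K.zeroˡ a⁻¹ ⟩
    0F                  ∎
    where open ≡-Reasoning

  coeff-∷-* : ∀ x t a j → coeff (mulP (x ∷ t) a) j ≡ (x *F coeff a j) +F coeff (0F ∷ mulP t a) j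
  coeff-∷-* x t a j =
    trans (coeff-addP (scale x a) (0F ∷ mulP t a) j) (cong (_+F coeff (0F ∷ mulP t a) j) (coeff-scale x a j))

  multiple-vanishing-from-degree : ∀ {a k} → coeff a k ≢ 0F → (∀ j → k ℕ.< j → coeff a j ≡ 0F) →
    ∀ t → (∀ j → k ℕ.≤ j → coeff (mulP t a) j ≡ 0F) → t ≋ []
  multiple-vanishing-from-degree _ _ [] _ = ≋-refl
  multiple-vanishing-from-degree {a} {k} aₖ≢0 a-above (x ∷ t) vanish = ∷-≋[] x≡0 t≋0
    where
    open ≡-Reasoning
    t≋0 : t ≋ []
    t≋0 = multiple-vanishing-from-degree aₖ≢0 a-above t λ j k≤j → begin
      coeff (mulP t a) j                                   ≡⟨ K.+-identityˡ _ ⟨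
      0F +F coeff (mulP t a) j                             ≡⟨ cong (_+F coeff (mulP t a) j) (trans (cong (x *F_) (a-above (suc j) (s≤s k≤j))) (K.zeroʳ x)) ⟨
      (x *F coeff a (suc j)) +F coeff (mulP t a) j         ≡⟨ coeff-∷-* x t a (suc j) ⟨
      coeff (mulP (x ∷ t) a) (suc j)                       ≡⟨ vanish (suc j) (ℕ.m≤n⇒m≤1+n k≤j) ⟩
      0F                                                   ∎
    x≡0 : x ≡ 0F
    x≡0 = no-zero-divisors aₖ≢0 (begin
      x *F coeff a k                                       ≡⟨ K.+-identityʳ _ ⟨
      (x *F coeff a k) +F 0F                               ≡⟨ cong ((x *F coeff a k) +F_) (coeff-≡ (∷-≋[] refl (*-congʳ {a} t≋0)) k) ⟨
      (x *F coeff a k) +F coeff (0F ∷ mulP t a) k          ≡⟨ coeff-∷-* x t a k ⟨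
      coeff (mulP (x ∷ t) a) k                             ≡⟨ vanish k ℕ.≤-refl ⟩
      0F                                                   ∎)

  coeff-drop : ∀ k p i → coeff (drop k p) i ≡ coeff p (k ℕ.+ i)
  coeff-drop zero    p       i = refl
  coeff-drop (suc k) []      i = refl
  coeff-drop (suc k) (a ∷ p) i = coeff-drop k p i

  drop-≡⇒coeff-≡ : ∀ k p p′ → drop k p ≡ drop k p′ → ∀ j → k ℕ.≤ j → coeff p j ≡ coeff p′ j
  drop-≡⇒coeff-≡ k p p′ e j k≤j = begin
    coeff p j                      ≡⟨ cong (coeff p) (ℕ.m+[n∸m]≡n k≤j) ⟨
    coeff p (k ℕ.+ (j ∸ k))        ≡⟨ coeff-drop k p (j ∸ k) ⟨
    coeff (drop k p) (j ∸ k)       ≡⟨ cong (λ r → coeff r (j ∸ k)) e ⟩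
    coeff (drop k p′) (j ∸ k)      ≡⟨ coeff-drop k p′ (j ∸ k) ⟩
    coeff p′ (k ℕ.+ (j ∸ k))       ≡⟨ cong (coeff p′) (ℕ.m+[n∸m]≡n k≤j) ⟩
    coeff p′ j                     ∎
    where open ≡-Reasoning

  quotient-unique : ∀ {a P Q u u′} → Normalized a → a ≢ [] →
    P * a + u ≋ Q * a + u′ → drop (length a ∸ 1) u ≡ drop (length a ∸ 1) u′ → P ≋ Q
  quotient-unique {[]} _ a≢[] = ⊥-elim (a≢[] refl)
  quotient-unique {a₀ ∷ ar} {P} {Q} {u} {u′} na _ e high = x∙y⁻¹≈ε⇒x≈y P Q
    (multiple-vanishing-from-degree (leading-nonzero na) (λ j → coeff-beyond-length (a₀ ∷ ar)) (P - Q) vanish)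
    where
    a : Pol
    a = a₀ ∷ ar
    open ≡-Reasoning
    vanish : ∀ j → length ar ℕ.≤ j → coeff ((P - Q) * a) j ≡ 0F
    vanish j ar≤j = begin
      coeff ((P - Q) * a) j                   ≡⟨ coeff-≡ ([y-z]x≈yx-zx a P Q) j ⟩
      coeff (P * a - Q * a) j                 ≡⟨ coeff-addP (P * a) (- (Q * a)) j ⟩
      coeff (P * a) j +F coeff (- (Q * a)) j  ≡⟨ cong₂ _+F_ Pa≡Qa (coeff-negP (Q * a) j) ⟩
      coeff (Q * a) j +F (-F coeff (Q * a) j) ≡⟨ K.-‿inverseʳ _ ⟩
      0F                                      ∎
      where
      Pa≡Qa : coeff (P * a) j ≡ coeff (Q * a) j
      Pa≡Qa = K.+-cancelʳ (coeff u j) _ _ (begin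
        coeff (P * a) j +F coeff u j      ≡⟨ coeff-addP (P * a) u j ⟨
        coeff (P * a + u) j               ≡⟨ coeff-≡ e j ⟩
        coeff (Q * a + u′) j              ≡⟨ coeff-addP (Q * a) u′ j ⟩
        coeff (Q * a) j +F coeff u′ j     ≡⟨ cong (coeff (Q * a) j +F_) (drop-≡⇒coeff-≡ (length ar) u u′ high j ar≤j) ⟨
        coeff (Q * a) j +F coeff u j      ∎)

  open Determinants polynomialRing using (same-first-column; zero-column⇒1≈0)

  -- The coefficients of a second column (y, w) that its first column (x, z) leaves free:
  -- those of y of degree ≥ deg x if deg z ≤ deg x, else those of w of degree ≥ deg z.
  highPart : Pol → Pol → Pol → Pol → Pol
  highPart x z y w with length z ℕ.≤? length x
  ... | yes _ = drop (length x ∸ 1) y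
  ... | no  _ = drop (length z ∸ 1) w

  length≤0⇒≡[] : ∀ {p : Pol} → length p ℕ.≤ 0 → p ≡ []
  length≤0⇒≡[] {[]} _ = refl

  column-nonzero : ∀ {x y z w s} → x * w - y * z ≋ s → s * s ≋ 1# → x ≡ [] → z ≡ [] → ⊥
  column-nonzero {y = y} {w = w} d s²≈1 refl refl = 1≉0 (zero-column⇒1≈0 {y = y} {w = w} ≋-refl ≋-refl d s²≈1)

  longer-≢[] : ∀ {x z : Pol} → (x ≡ [] → z ≡ [] → ⊥) → length z ℕ.≤ length x → x ≢ []
  longer-≢[] nonzero z≤x refl = nonzero refl (length≤0⇒≡[] z≤x)

  ≰-length⇒≢[] : ∀ {x z : Pol} → ¬ length z ℕ.≤ length x → z ≢ []
  ≰-length⇒≢[] z≰x refl = z≰x z≤n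

  multiplier-unique : ∀ {x z y w y′ w′ t t′} → Normalized x → Normalized z → (x ≡ [] → z ≡ [] → ⊥) →
    t * x + y ≋ t′ * x + y′ → t * z + w ≋ t′ * z + w′ → highPart x z y w ≡ highPart x z y′ w′ → t ≋ t′
  multiplier-unique {x} {z} nx nz nonzero ex ez high with length z ℕ.≤? length x
  ... | yes z≤x = quotient-unique nx (longer-≢[] {x} {z} nonzero z≤x) ex high
  ... | no  z≰x = quotient-unique nz (≰-length⇒≢[] {x} {z} z≰x) ez high

  second-column-unique : ∀ {x y z w y′ w′ s} →
    Normalized x → Normalized z → Normalized y → Normalized w → Normalized y′ → Normalized w′ →
    x * w - y * z ≋ s → x * w′ - y′ * z ≋ s → s * s ≋ 1# →
    highPart x z y w ≡ highPart x z y′ w′ → y ≡ y′ × w ≡ w′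
  second-column-unique {x} {y} {z} {w} {y′} {w′} {s} nx nz ny nw ny′ nw′ d d′ s²≈1 high =
    normalized-≋⇒≡ ny ny′ (cancel-multiple ex) , normalized-≋⇒≡ nw nw′ (cancel-multiple ez)
    where
    t t′ : Pol
    t = s * (w * y′)
    t′ = s * (y * w′)
    ex : t * x + y ≋ t′ * x + y′
    ex = proj₁ (same-first-column {x} {y} {z} {w} {y′} {w′} {s} d d′ s²≈1)
    ez : t * z + w ≋ t′ * z + w′
    ez = proj₂ (same-first-column {x} {y} {z} {w} {y′} {w′} {s} d d′ s²≈1)
    t≋t′ : t ≋ t′
    t≋t′ = multiplier-unique {x} {z} {y} {w} {y′} {w′} nx nz (column-nonzero {x} {y} {z} {w} d s²≈1) ex ez high
    cancel-multiple : ∀ {a u u′} → t * a + u ≋ t′ * a + u′ → u ≋ u′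
    cancel-multiple {a} {u} {u′} e = +-cancelˡ (t * a) u u′ (≋-trans e (+-congʳ (*-congʳ {a} (≋-sym t≋t′))))

module NaturalRationals where
  open import Data.Integer using (+_; -[1+_]; +≤+; -≤+)
  import Data.Integer as ℤ
  import Data.Integer.Properties as ℤ
  import Data.Nat.Coprimality as Coprimality
  open import Data.Rational as ℚ using (mkℚ; _/_; *≤*; NonNegative)
  import Data.Rational.Properties as ℚ

  fromℕ : ℕ → ℚ
  fromℕ n = + n / 1

  fromℕ≡mkℚ : ∀ n → fromℕ n ≡ mkℚ (+ n) 0 (Coprimality.sym (Coprimality.1-coprimeTo n))
  fromℕ≡mkℚ n = ℚ.normalize-coprime (Coprimality.sym (Coprimality.1-coprimeTo n))

  fromℕ-mono-≤ : ∀ {m n} → m ℕ.≤ n → fromℕ m ℚ.≤ fromℕ n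
  fromℕ-mono-≤ {m} {n} m≤n rewrite fromℕ≡mkℚ m | fromℕ≡mkℚ n =
    *≤* (subst₂ ℤ._≤_ (sym (ℤ.*-identityʳ (+ m))) (sym (ℤ.*-identityʳ (+ n))) (+≤+ m≤n))

  fromℕ-cancel-≤ : ∀ {m n} → fromℕ m ℚ.≤ fromℕ n → m ℕ.≤ n
  fromℕ-cancel-≤ {m} {n} m≤n rewrite fromℕ≡mkℚ m | fromℕ≡mkℚ n =
    ℤ.drop‿+≤+ (subst₂ ℤ._≤_ (ℤ.*-identityʳ (+ m)) (ℤ.*-identityʳ (+ n)) (ℚ.drop-*≤* m≤n))

  fromℕ-* : ∀ m n → fromℕ (m ℕ.* n) ≡ fromℕ m ℚ.* fromℕ n
  fromℕ-* m n rewrite fromℕ≡mkℚ m | fromℕ≡mkℚ n = ℚ./-cong {p₁ = + (m ℕ.* n)} {q₁ = 1} (ℤ.pos-* m n) refl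

  fromℕ-nonNeg : ∀ n → NonNegative (fromℕ n)
  fromℕ-nonNeg n = subst NonNegative (sym (fromℕ≡mkℚ n)) _

  ≤fromℕ : ∀ B → Σ ℕ λ K → B ℚ.≤ fromℕ K
  ≤fromℕ B@(mkℚ (+ n) d _) = n , subst (B ℚ.≤_) (sym (fromℕ≡mkℚ n))
    (*≤* (subst₂ ℤ._≤_ (sym (ℤ.*-identityʳ (+ n))) (ℤ.pos-* n (suc d)) (+≤+ (ℕ.m≤m*n n (suc d)))))
  ≤fromℕ B@(mkℚ -[1+ n ] _ _) = 0 , subst (B ℚ.≤_) (sym (fromℕ≡mkℚ 0))
    (*≤* (subst (ℤ._≤ + 0) (sym (ℤ.*-identityʳ -[1+ n ])) -≤+))

  product-bound : ∀ {n C X Y B₁ B₂} → n ℕ.≤ C ℕ.* X ℕ.* Y → fromℕ X ℚ.≤ B₁ → fromℕ Y ℚ.≤ B₂ →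
    fromℕ n ℚ.≤ fromℕ C ℚ.* B₁ ℚ.* B₂
  product-bound {n} {C} {X} {Y} {B₁} {B₂} n≤CXY X≤B₁ Y≤B₂ = begin
    fromℕ n                              ≤⟨ fromℕ-mono-≤ n≤CXY ⟩
    fromℕ (C ℕ.* X ℕ.* Y)                ≡⟨ trans (fromℕ-* (C ℕ.* X) Y) (cong (ℚ._* fromℕ Y) (fromℕ-* C X)) ⟩
    fromℕ C ℚ.* fromℕ X ℚ.* fromℕ Y      ≤⟨ ℚ.*-monoʳ-≤-nonNeg (fromℕ Y) {{fromℕ-nonNeg Y}} (ℚ.*-monoˡ-≤-nonNeg (fromℕ C) {{fromℕ-nonNeg C}} X≤B₁) ⟩
    fromℕ C ℚ.* B₁ ℚ.* fromℕ Y           ≤⟨ ℚ.*-monoˡ-≤-nonNeg (fromℕ C ℚ.* B₁) {{CB₁-nonNeg}} Y≤B₂ ⟩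
    fromℕ C ℚ.* B₁ ℚ.* B₂                ∎
    where
    open ℚ.≤-Reasoning
    CB₁-nonNeg : NonNegative (fromℕ C ℚ.* B₁)
    CB₁-nonNeg = ℚ.nonNeg*nonNeg⇒nonNeg (fromℕ C) {{fromℕ-nonNeg C}} B₁
      {{ℚ.nonNegative (ℚ.≤-trans (fromℕ-mono-≤ {0} {X} z≤n) X≤B₁)}}

distinct⇒2≤ : ∀ {n} (i j : Fin n) → i ≢ j → 2 ℕ.≤ n
distinct⇒2≤ {suc zero}    Fin.zero Fin.zero i≢j = ⊥-elim (i≢j refl)
distinct⇒2≤ {suc (suc n)} _        _        _   = s≤s (s≤s z≤n)

n<m^n : ∀ {m} → 2 ℕ.≤ m → ∀ n → n ℕ.< m ℕ.^ n
n<m^n 2≤m zero    = s≤s z≤n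
n<m^n {m} 2≤m (suc n) = begin-strict
  suc n                    <⟨ ℕ.+-mono-≤ (ℕ.≤-trans (s≤s z≤n) IH) IH ⟩
  m ℕ.^ n ℕ.+ m ℕ.^ n      ≡⟨ cong (m ℕ.^ n ℕ.+_) (ℕ.+-identityʳ (m ℕ.^ n)) ⟨
  2 ℕ.* m ℕ.^ n            ≤⟨ ℕ.*-monoˡ-≤ (m ℕ.^ n) 2≤m ⟩
  m ℕ.* m ℕ.^ n            ∎
  where
  open ℕ.≤-Reasoning
  IH : n ℕ.< m ℕ.^ n
  IH = n<m^n 2≤m n

initial-segment : ∀ {P : ℕ → Set} → Decidable P → (∀ {m n} → m ℕ.≤ n → P n → P m) → ∀ K → ¬ P K →
  Σ ℕ λ n → (∀ j → P j → j ℕ.< n) × (∀ j → j ℕ.< n → P j)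
initial-segment P? down zero    ¬P0 = 0 , (λ j Pj → ⊥-elim (¬P0 (down z≤n Pj))) , λ j ()
initial-segment P? down (suc K) ¬PsK with P? K
... | yes PK  = suc K , (λ j Pj → ℕ.≰⇒> (λ sK≤j → ¬PsK (down sK≤j Pj))) , λ j j<sK → down (ℕ.s≤s⁻¹ j<sK) PK
... | no  ¬PK = initial-segment P? down K ¬PK

module Enumeration where
  open import Data.Nat using (_+_; _*_; _^_; _≤_)
  open import Data.List.Properties using (length-++; length-map; length-drop)
  open import Data.List.Membership.Propositional.Properties
    using (∈-++⁺ˡ; ∈-++⁺ʳ; ∈-cartesianProductWith⁺; ∈-filter⁺)
  open import Data.List.Relation.Unary.All as All using (All; _∷_)
  open import Data.List.Relation.Unary.All.Properties using (all-filter)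
  open import Data.List.Relation.Unary.Any using (here; there)
  open import Relation.Binary.Definitions using (DecidableEquality)
  open import Relation.Nullary.Decidable using (_×-dec_)

  length-cartesianProductWith : ∀ {A B C : Set} (f : A → B → C) xs ys →
    length (cartesianProductWith f xs ys) ≡ length xs * length ys
  length-cartesianProductWith f []       ys = refl
  length-cartesianProductWith f (x ∷ xs) ys = trans (length-++ (map (f x) ys))
    (cong₂ _+_ (length-map (f x) ys) (length-cartesianProductWith f xs ys))

  length∸1< : ∀ {A : Set} {p : List A} {n} → p ≢ [] → length p ≤ n → length p ∸ 1 ℕ.< n
  length∸1< {p = []}    p≢[] _   = ⊥-elim (p≢[] refl)
  length∸1< {p = _ ∷ _} _    p≤n = p≤n

  length-drop-≤ : ∀ {A : Set} k {p : List A} {m} → length p ≤ m → length (drop k p) ≤ m ∸ k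
  length-drop-≤ k {p} p≤m = subst (_≤ _) (sym (length-drop k p)) (ℕ.∸-monoˡ-≤ k p≤m)

  module _ {A : Set} (xs : List A) where
    words : ℕ → List (List A)
    words zero    = [ [] ]
    words (suc n) = cartesianProductWith _∷_ xs (words n)

    length-words : ∀ n → length (words n) ≡ length xs ^ n
    length-words zero    = refl
    length-words (suc n) = trans (length-cartesianProductWith _∷_ xs (words n)) (cong (length xs *_) (length-words n))

    ∈-words : (∀ a → a ∈ xs) → ∀ p → p ∈ words (length p)
    ∈-words complete []      = here refl
    ∈-words complete (a ∷ p) = ∈-cartesianProductWith⁺ _∷_ (complete a) (∈-words complete p)

  module _ {M K : Set} (code : M → K) {P : M → Set} (P? : Decidable P) (_≟_ : DecidableEquality K)
           (code-injective : ∀ {m m′} → P m → P m′ → code m ≡ code m′ → m ≡ m′) where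

    select : List K → List M → List M
    select []       ms = []
    select (k ∷ ks) ms = take 1 (filter (λ m → code m ≟ k ×-dec P? m) ms) ++ select ks ms

    length-select : ∀ ks ms → length (select ks ms) ≤ length ks
    length-select []       ms = z≤n
    length-select (k ∷ ks) ms = ℕ.≤-trans (ℕ.≤-reflexive (length-++ (take 1 candidates)))
      (ℕ.+-mono-≤ (length-take-1 candidates) (length-select ks ms))
      where
      candidates : List M
      candidates = filter (λ m → code m ≟ k ×-dec P? m) ms
      length-take-1 : ∀ (ys : List M) → length (take 1 ys) ≤ 1
      length-take-1 []      = z≤n
      length-take-1 (_ ∷ _) = s≤s z≤n

    ∈-select : ∀ {m ks ms} → P m → m ∈ ms → code m ∈ ks → m ∈ select ks ms
    ∈-select {m} {k ∷ ks} {ms} pm m∈ms (here refl) = ∈-++⁺ˡ (head-of-constant candidates≡m (∈-filter⁺ Q? m∈ms (refl , pm)))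
      where
      Q? : Decidable λ m′ → code m′ ≡ code m × P m′
      Q? = λ m′ → code m′ ≟ code m ×-dec P? m′
      candidates≡m : All (_≡ m) (filter Q? ms)
      candidates≡m = All.map (λ (e , pm′) → code-injective pm′ pm e) (all-filter Q? ms)
      head-of-constant : ∀ {ys} → All (_≡ m) ys → m ∈ ys → m ∈ take 1 ys
      head-of-constant (y≡m ∷ _) _ = here (sym y≡m)
    ∈-select {ks = k ∷ ks} pm m∈ms (there c∈ks) = ∈-++⁺ʳ _ (∈-select pm m∈ms c∈ks)


module Counting (q : ℕ) (F : FieldOn (Fin q)) where
  open import Data.Nat using (_+_; _*_; _^_; _≤_; _<_)
  open import Data.Nat.Solver using (module +-*-Solver)
  open import Data.List.Properties using (length-++; length-map; length-replicate; length-tabulate)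
  import Data.List.Properties as List
  open import Data.List.Membership.Propositional.Properties
    using (∈-++⁺ˡ; ∈-++⁺ʳ; ∈-map⁺; ∈-allFin; ∈-cartesianProduct⁺)
  import Data.Fin.Properties as Fin
  import Data.Rational.Properties as ℚ
  open import Data.Product.Properties using (,-injectiveˡ; ,-injectiveʳ)
  import Data.Product.Properties as Product
  open import Data.Sum using (inj₁; inj₂)
  open import Relation.Nullary using (Dec)
  open import Relation.Nullary.Decidable using (_×-dec_)
  open FieldOn F
  open Poly F
  open SL2 q F
  open Polynomials F
  module P where
    open CommutativeRing polynomialRing public
  open Enumeration
  open NaturalRationals
  open +-*-Solver using (solve; _:+_; _:*_; _:=_; con)

  Mat : Set
  Mat = Mat2 (Fin q)

  2≤q : 2 ≤ q
  2≤q = distinct⇒2≤ 0F 1F 0≢1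

  instance
    q-nonZero : ℕ.NonZero q
    q-nonZero = ℕ.>-nonZero (ℕ.≤-trans (s≤s z≤n) 2≤q)

  -- the largest |p| of a list p of length ≤ n
  maxAbs : ℕ → ℕ
  maxAbs zero    = 0
  maxAbs (suc n) = q ^ n

  length-bound : ∀ B → 0ℚ ℚ.< B →
    Σ ℕ λ n → (∀ (p : Pol) → absℚ q p ℚ.≤ B → length p ≤ n) × fromℕ (maxAbs n) ℚ.≤ B
  length-bound B 0<B with initial-segment (λ j → fromℕ (q ^ j) ℚ.≤? B) power-antitone K ¬q^K≤B
    where
    power-antitone : ∀ {i j} → i ≤ j → fromℕ (q ^ j) ℚ.≤ B → fromℕ (q ^ i) ℚ.≤ B
    power-antitone i≤j = ℚ.≤-trans (fromℕ-mono-≤ (ℕ.^-monoʳ-≤ q i≤j))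
    K : ℕ
    K = proj₁ (≤fromℕ B)
    ¬q^K≤B : ¬ fromℕ (q ^ K) ℚ.≤ B
    ¬q^K≤B q^K≤B = ℕ.<⇒≱ (n<m^n 2≤q K) (fromℕ-cancel-≤ (ℚ.≤-trans q^K≤B (proj₂ (≤fromℕ B))))
  ... | n , below , above = n , fits , maxAbs≤B n above
    where
    fits : ∀ (p : Pol) → absℚ q p ℚ.≤ B → length p ≤ n
    fits []      _ = z≤n
    fits (a ∷ p) h = below (length p) h
    maxAbs≤B : ∀ n → (∀ j → j < n → fromℕ (q ^ j) ℚ.≤ B) → fromℕ (maxAbs n) ℚ.≤ B
    maxAbs≤B zero    _     = ℚ.<⇒≤ 0<B
    maxAbs≤B (suc n) above = above n (ℕ.n<1+n n)

  ++-zeros-≋ : ∀ p k → p ++ replicate k 0F ≋ p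
  ++-zeros-≋ []      zero    = ≋-refl
  ++-zeros-≋ []      (suc k) = ∷-≋[] refl (++-zeros-≋ [] k)
  ++-zeros-≋ (a ∷ p) k       = ∷-cong refl (++-zeros-≋ p k)

  polys : ℕ → List Pol
  polys n = map normalize (words (allFin q) n)

  length-polys : ∀ n → length (polys n) ≡ q ^ n
  length-polys n = trans (length-map normalize (words (allFin q) n))
    (trans (length-words (allFin q) n) (cong (_^ n) (length-tabulate (λ i → i))))

  ∈-polys : ∀ {n p} → Normalized p → length p ≤ n → p ∈ polys n
  ∈-polys {n} {p} np p≤n = subst (_∈ polys n) normalize-padded (∈-map⁺ normalize padded∈words)
    where
    padded : Pol
    padded = p ++ replicate (n ∸ length p) 0F
    normalize-padded : normalize padded ≡ p
    normalize-padded = normalized-≋⇒≡ (normalize-normalized padded) np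
      (≋-trans (normalize-≋ padded) (++-zeros-≋ p (n ∸ length p)))
    length-padded : length padded ≡ n
    length-padded = trans (length-++ p) (trans (cong (length p +_) (length-replicate (n ∸ length p))) (ℕ.m+[n∸m]≡n p≤n))
    padded∈words : padded ∈ words (allFin q) n
    padded∈words = subst (λ m → padded ∈ words (allFin q) m) length-padded (∈-words (allFin q) ∈-allFin padded)

  Code : Set
  Code = Pol × Pol × Pol

  -- Codes of matrices whose columns have lengths ≤ n and ≤ m (n ≤ m): if the longer entry
  -- of the first column has length k + 1, then the free part has length ≤ m ∸ k.
  codes : ℕ → ℕ → List Code
  codes m zero    = []
  codes m (suc k) = cartesianProduct (polys (suc k)) (cartesianProduct (polys (suc k)) (polys (m ∸ k))) ++ codes m k

  ∈-codes : ∀ {m n x z h} k → k < n → x ∈ polys (suc k) → z ∈ polys (suc k) → h ∈ polys (m ∸ k) →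
    (x , z , h) ∈ codes m n
  ∈-codes {n = suc n} k (s≤s k≤n) x∈ z∈ h∈ with ℕ.m≤n⇒m<n∨m≡n k≤n
  ... | inj₂ refl = ∈-++⁺ˡ (∈-cartesianProduct⁺ x∈ (∈-cartesianProduct⁺ z∈ h∈))
  ... | inj₁ k<n  = ∈-++⁺ʳ _ (∈-codes k k<n x∈ z∈ h∈)

  length-codes-block : ∀ {m k} → k ≤ m →
    length (cartesianProduct (polys (suc k)) (cartesianProduct (polys (suc k)) (polys (m ∸ k)))) ≡ q ^ (2 + m) * q ^ k
  length-codes-block {m} {k} k≤m = begin
    length (cartesianProduct (polys (suc k)) (cartesianProduct (polys (suc k)) (polys (m ∸ k))))
      ≡⟨ trans (length-cartesianProductWith _,_ (polys (suc k)) _)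
               (cong (length (polys (suc k)) *_) (length-cartesianProductWith _,_ (polys (suc k)) (polys (m ∸ k)))) ⟩
    length (polys (suc k)) * (length (polys (suc k)) * length (polys (m ∸ k)))
      ≡⟨ cong₂ _*_ (length-polys (suc k)) (cong₂ _*_ (length-polys (suc k)) (length-polys (m ∸ k))) ⟩
    q * q ^ k * (q * q ^ k * q ^ (m ∸ k))
      ≡⟨ solve 3 (λ q a b → q :* a :* (q :* a :* b) := q :* (q :* (a :* b)) :* a) refl q (q ^ k) (q ^ (m ∸ k)) ⟩
    q * (q * (q ^ k * q ^ (m ∸ k))) * q ^ k
      ≡⟨ cong (λ e → q * (q * e) * q ^ k) (ℕ.^-distribˡ-+-* q k (m ∸ k)) ⟨
    q * (q * q ^ (k + (m ∸ k))) * q ^ k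
      ≡⟨ cong (λ e → q * (q * q ^ e) * q ^ k) (ℕ.m+[n∸m]≡n k≤m) ⟩
    q ^ (2 + m) * q ^ k ∎
    where open ≡-Reasoning

  length-codes-geometric : ∀ {m n} → n ≤ m → length (codes m n) ≤ q ^ (2 + m) * q ^ n
  length-codes-geometric {m} {zero}  _   = z≤n
  length-codes-geometric {m} {suc k} k<m = begin
    length (block ++ codes m k)            ≡⟨ length-++ block ⟩
    length block + length (codes m k)      ≤⟨ ℕ.+-mono-≤ (ℕ.≤-reflexive (length-codes-block (ℕ.<⇒≤ k<m)))
                                                         (length-codes-geometric (ℕ.<⇒≤ k<m)) ⟩
    W * q ^ k + W * q ^ k                  ≡⟨ solve 2 (λ W a → W :* a :+ W :* a := W :* (con 2 :* a)) refl W (q ^ k) ⟩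
    W * (2 * q ^ k)                        ≤⟨ ℕ.*-monoʳ-≤ W (ℕ.*-monoˡ-≤ (q ^ k) 2≤q) ⟩
    W * q ^ suc k                          ∎
    where
    open ℕ.≤-Reasoning
    block : List Code
    block = cartesianProduct (polys (suc k)) (cartesianProduct (polys (suc k)) (polys (m ∸ k)))
    W : ℕ
    W = q ^ (2 + m)

  length-codes : ∀ {m n} → n ≤ m → length (codes m n) ≤ q ^ 4 * maxAbs n * maxAbs m
  length-codes {m}     {zero}  _   = z≤n
  length-codes {suc m} {suc n} n≤m = ℕ.≤-trans (length-codes-geometric n≤m) (ℕ.≤-reflexive
    (solve 3 (λ q a b → q :* (q :* (q :* b)) :* (q :* a) := q :* (q :* (q :* (q :* con 1))) :* a :* b) refl q (q ^ n) (q ^ m)))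

  highPart∈codes : ∀ {m n x z y w} → Normalized x → Normalized z → Normalized y → Normalized w →
    (x ≡ [] → z ≡ [] → ⊥) → length x ≤ n → length z ≤ n → length y ≤ m → length w ≤ m →
    (x , z , highPart x z y w) ∈ codes m n
  highPart∈codes {m} {n} {x} {z} {y} {w} nx nz ny nw nonzero |x|≤n |z|≤n |y|≤m |w|≤m with length z ℕ.≤? length x
  ... | yes z≤x = ∈-codes (length x ∸ 1) (length∸1< (longer-≢[] {x} {z} nonzero z≤x) |x|≤n)
    (∈-polys nx (ℕ.m≤n+m∸n (length x) 1)) (∈-polys nz (ℕ.≤-trans z≤x (ℕ.m≤n+m∸n (length x) 1)))
    (∈-polys (drop-normalized (length x ∸ 1) ny) (length-drop-≤ (length x ∸ 1) |y|≤m))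
  ... | no z≰x = ∈-codes (length z ∸ 1) (length∸1< (≰-length⇒≢[] {x} {z} z≰x) |z|≤n)
    (∈-polys nx (ℕ.≤-trans (ℕ.<⇒≤ (ℕ.≰⇒> z≰x)) (ℕ.m≤n+m∸n (length z) 1))) (∈-polys nz (ℕ.m≤n+m∸n (length z) 1))
    (∈-polys (drop-normalized (length z ∸ 1) nw) (length-drop-≤ (length z ∸ 1) |w|≤m))

  firstColumnCode : Mat → Code
  firstColumnCode (a , b , c , d) = a , c , highPart a c b d

  secondColumnCode : Mat → Code
  secondColumnCode (a , b , c , d) = b , d , highPart b d a c

  open Determinants polynomialRing using (det-swapColumns; [-1]²≈1)

  unimodular : ∀ {a b c d} → InSL2 (a , b , c , d) → addP (mulP a d) (negP (mulP b c)) ≋ oneP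
  unimodular (_ , _ , _ , _ , det) = ≈P⇒≋ det

  firstColumnCode-injective : ∀ {M M′} → InSL2 M → InSL2 M′ → firstColumnCode M ≡ firstColumnCode M′ → M ≡ M′
  firstColumnCode-injective {a , b , c , d} {a′ , b′ , c′ , d′} sl sl′ same =
    same-first-column (,-injectiveˡ same) (,-injectiveˡ (,-injectiveʳ same)) sl sl′ (,-injectiveʳ (,-injectiveʳ same))
    where
    same-first-column : a ≡ a′ → c ≡ c′ → InSL2 (a , b , c , d) → InSL2 (a′ , b′ , c′ , d′) →
      highPart a c b d ≡ highPart a′ c′ b′ d′ → (a , b , c , d) ≡ (a′ , b′ , c′ , d′)
    same-first-column refl refl sl@(na , nb , nc , nd , _) sl′@(_ , nb′ , _ , nd′ , _) high =
      let b≡b′ , d≡d′ = second-column-unique na nc nb nd nb′ nd′ (unimodular sl) (unimodular sl′) (P.*-identityˡ P.1#) high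
      in cong₂ (λ b d → a , b , c , d) b≡b′ d≡d′

  secondColumnCode-injective : ∀ {M M′} → InSL2 M → InSL2 M′ → secondColumnCode M ≡ secondColumnCode M′ → M ≡ M′
  secondColumnCode-injective {a , b , c , d} {a′ , b′ , c′ , d′} sl sl′ same =
    same-second-column (,-injectiveˡ same) (,-injectiveˡ (,-injectiveʳ same)) sl sl′ (,-injectiveʳ (,-injectiveʳ same))
    where
    same-second-column : b ≡ b′ → d ≡ d′ → InSL2 (a , b , c , d) → InSL2 (a′ , b′ , c′ , d′) →
      highPart b d a c ≡ highPart b′ d′ a′ c′ → (a , b , c , d) ≡ (a′ , b′ , c′ , d′)
    same-second-column refl refl sl@(na , nb , nc , nd , _) sl′@(na′ , _ , nc′ , _ , _) high =
      let a≡a′ , c≡c′ = second-column-unique nb nd na nc na′ nc′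
                          (det-swapColumns {a} {b} {c} {d} (unimodular sl)) (det-swapColumns {a′} {b} {c′} {d} (unimodular sl′)) [-1]²≈1 high
      in cong₂ (λ a c → a , b , c , d) a≡a′ c≡c′

  normalized? : ∀ p → Dec (Normalized p)
  normalized? []          = yes nil
  normalized? (a ∷ [])    with a ≟F 0F
  ... | yes a≡0 = no λ { (last a≢0) → a≢0 a≡0 }
  ... | no  a≢0 = yes (last a≢0)
  normalized? (a ∷ b ∷ p) with normalized? (b ∷ p)
  ... | yes n  = yes (cons n)
  ... | no  ¬n = no λ { (cons n) → ¬n n }

  _≟P_ : (p p′ : Pol) → Dec (p ≡ p′)
  _≟P_ = List.≡-dec Fin._≟_

  inSL2? : ∀ M → Dec (InSL2 M)
  inSL2? (a , b , c , d) = normalized? a ×-dec normalized? b ×-dec normalized? c ×-dec normalized? d ×-dec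
    normalize (addP (mulP a d) (negP (mulP b c))) ≟P normalize oneP

  _≟C_ : (e e′ : Code) → Dec (e ≡ e′)
  _≟C_ = Product.≡-dec _≟P_ (Product.≡-dec _≟P_ _≟P_)

  matrices : ℕ → ℕ → List Mat
  matrices n₁ n₂ = cartesianProduct (polys n₁) (cartesianProduct (polys n₂) (cartesianProduct (polys n₁) (polys n₂)))

  FitsColumns : ℕ → ℕ → Mat → Set
  FitsColumns n₁ n₂ (a , b , c , d) = (length a ≤ n₁ × length c ≤ n₁) × (length b ≤ n₂ × length d ≤ n₂)

  ∈-matrices : ∀ {n₁ n₂ M} → InSL2 M → FitsColumns n₁ n₂ M → M ∈ matrices n₁ n₂
  ∈-matrices {M = a , b , c , d} (na , nb , nc , nd , _) ((|a| , |c|) , (|b| , |d|)) = ∈-cartesianProduct⁺ (∈-polys na |a|)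
    (∈-cartesianProduct⁺ (∈-polys nb |b|) (∈-cartesianProduct⁺ (∈-polys nc |c|) (∈-polys nd |d|)))

  firstColumnCode∈codes : ∀ {n₁ n₂ M} → InSL2 M → FitsColumns n₁ n₂ M → firstColumnCode M ∈ codes n₂ n₁
  firstColumnCode∈codes {M = a , b , c , d} sl@(na , nb , nc , nd , _) ((|a| , |c|) , (|b| , |d|)) =
    highPart∈codes na nc nb nd (column-nonzero {a} {b} {c} {d} (unimodular sl) (P.*-identityˡ P.1#)) |a| |c| |b| |d|

  secondColumnCode∈codes : ∀ {n₁ n₂ M} → InSL2 M → FitsColumns n₁ n₂ M → secondColumnCode M ∈ codes n₁ n₂
  secondColumnCode∈codes {M = a , b , c , d} sl@(na , nb , nc , nd , _) ((|a| , |c|) , (|b| , |d|)) =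
    highPart∈codes nb nd na nc (column-nonzero {b} {a} {d} {c} (det-swapColumns {a} {b} {c} {d} (unimodular sl)) [-1]²≈1)
      |b| |d| |a| |c|

  columns-enumeration : ∀ n₁ n₂ → Σ (List Mat) λ L → length L ≤ q ^ 4 * maxAbs n₁ * maxAbs n₂ ×
    (∀ M → InSL2 M → FitsColumns n₁ n₂ M → M ∈ L)
  columns-enumeration n₁ n₂ with n₁ ℕ.≤? n₂
  ... | yes n₁≤n₂ =
    select firstColumnCode inSL2? _≟C_ firstColumnCode-injective (codes n₂ n₁) (matrices n₁ n₂) ,
    ℕ.≤-trans (length-select _ inSL2? _≟C_ firstColumnCode-injective (codes n₂ n₁) _) (length-codes n₁≤n₂) ,
    λ M sl fits → ∈-select _ inSL2? _≟C_ firstColumnCode-injective sl (∈-matrices sl fits) (firstColumnCode∈codes sl fits)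
  ... | no n₁≰n₂ =
    select secondColumnCode inSL2? _≟C_ secondColumnCode-injective (codes n₁ n₂) (matrices n₁ n₂) ,
    ℕ.≤-trans (length-select _ inSL2? _≟C_ secondColumnCode-injective (codes n₁ n₂) _)
      (ℕ.≤-trans (length-codes (ℕ.<⇒≤ (ℕ.≰⇒> n₁≰n₂)))
        (ℕ.≤-reflexive (solve 3 (λ C a b → C :* a :* b := C :* b :* a) refl (q ^ 4) (maxAbs n₂) (maxAbs n₁)))) ,
    λ M sl fits → ∈-select _ inSL2? _≟C_ secondColumnCode-injective sl (∈-matrices sl fits) (secondColumnCode∈codes sl fits)

  columns-bounded : ∀ B₁ B₂ → 0ℚ ℚ.< B₁ → 0ℚ ℚ.< B₂ → Σ (List Mat) λ L →
    fromℕ (length L) ℚ.≤ fromℕ (q ^ 4) ℚ.* B₁ ℚ.* B₂ × (∀ M → InSL2 M → ColsBounded B₁ B₂ M → M ∈ L)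
  columns-bounded B₁ B₂ 0<B₁ 0<B₂ =
    let n₁ , fits₁ , maxAbs≤B₁ = length-bound B₁ 0<B₁
        n₂ , fits₂ , maxAbs≤B₂ = length-bound B₂ 0<B₂
        L , |L| , covers = columns-enumeration n₁ n₂
    in L , product-bound {C = q ^ 4} {X = maxAbs n₁} {Y = maxAbs n₂} |L| maxAbs≤B₁ maxAbs≤B₂ ,
       λ { M@(a , b , c , d) sl ((|a| , |c|) , (|b| , |d|)) →
           covers M sl ((fits₁ a |a| , fits₁ c |c|) , (fits₂ b |b| , fits₂ d |d|)) }

  transpose : Mat → Mat
  transpose (a , b , c , d) = a , c , b , d

  transpose-InSL2 : ∀ {M} → InSL2 M → InSL2 (transpose M)
  transpose-InSL2 {a , b , c , d} sl@(na , nb , nc , nd , _) =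
    na , nc , nb , nd , ≋⇒≈P (≋-trans (P.+-congˡ {mulP a d} (P.-‿cong (P.*-comm c b))) (unimodular sl))

  rows-bounded : ∀ B₁ B₂ → 0ℚ ℚ.< B₁ → 0ℚ ℚ.< B₂ → Σ (List Mat) λ L →
    fromℕ (length L) ℚ.≤ fromℕ (q ^ 4) ℚ.* B₁ ℚ.* B₂ × (∀ M → InSL2 M → RowsBounded B₁ B₂ M → M ∈ L)
  rows-bounded B₁ B₂ 0<B₁ 0<B₂ =
    let L , |L| , covers = columns-bounded B₁ B₂ 0<B₁ 0<B₂
    in map transpose L , subst (λ n → fromℕ n ℚ.≤ fromℕ (q ^ 4) ℚ.* B₁ ℚ.* B₂) (sym (length-map transpose L)) |L| ,
       λ { M@(a , b , c , d) sl rows → ∈-map⁺ transpose (covers (transpose M) (transpose-InSL2 sl) rows) }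

open import Data.Integer using (+_)
open import Data.Rational using (_/_; _≤_; _<_; _*_)

proposition4p11 :
  (q : ℕ) → Σ ℕ λ C → (F : FieldOn (Fin q)) → (B₁ B₂ : ℚ) → 0ℚ < B₁ → 0ℚ < B₂ →
    (Σ (List (Mat2 (Fin q))) λ L →
       ((+ length L) / 1 ≤ ((+ C) / 1 * B₁) * B₂) ×
       (∀ M → SL2.InSL2 q F M → SL2.ColsBounded q F B₁ B₂ M → M ∈ L))
    ×
    (Σ (List (Mat2 (Fin q))) λ L →
       ((+ length L) / 1 ≤ ((+ C) / 1 * B₁) * B₂) ×
       (∀ M → SL2.InSL2 q F M → SL2.RowsBounded q F B₁ B₂ M → M ∈ L))
proposition4p11 q = q ℕ.^ 4 , λ F B₁ B₂ 0<B₁ 0<B₂ →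
  Counting.columns-bounded q F B₁ B₂ 0<B₁ 0<B₂ , Counting.rows-bounded q F B₁ B₂ 0<B₁ 0<B₂
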